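{- Let $\lambda$ and $\varphi$ denote the Carmichael function and the Euler totient function, respectively. If $m$ and $n$ are relatively prime positive integers such that $\operatorname{cosocle}(m)>\operatorname{rad}(n)>1$, then $(1,n^{\lambda(m)k}-1,n^{\lambda(m)k})$ and $(1,n^{\varphi(m)k}-1,n^{\varphi(m)k})$ are $abc$ triples for each positive integer $k$.
   Context: $\lambda(m)$ is the least positive integer such that $a^{\lambda(m)}\equiv 1\pmod m$ for every integer $a$ coprime to $m$. For a positive integer $n$, $\operatorname{rad}(n)$ denotes the product of the distinct prime factors of $n$ (with $\operatorname{rad}(1)=1$), and $\operatorname{cosocle}(n)=\frac{n}{\operatorname{rad}(n)}$. An $abc$ triple is a triple $(a,b,c)$ of relatively prime positive integers with $a+b=c$ and $\operatorname{rad}(abc)<c$. -}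

module Defs where

open import Data.Nat using (ℕ; zero; suc; _*_; _+_; _∸_; _^_; _≤_; _<_; NonZero)
open import Data.Nat.Properties using (m*n≢0)
open import Data.Nat.DivMod using (_/_; _%_)
open import Data.Nat.Divisibility using (_∣?_)
open import Data.Nat.Primality using (prime?)
open import Data.Nat.Coprimality using (Coprime; coprime?)
open import Data.List using (List; []; _∷_; applyUpTo; filter; length)
open import Data.Nat.ListAction using (product)
open import Data.Product using (_×_)
open import Relation.Nullary using (does)
open import Relation.Nullary.Decidable using (_×-dec_)
open import Relation.Binary.PropositionalEquality using (_≡_)
open import Data.Bool using (true; false)

φ : ℕ → ℕ
φ m = length (filter (λ k → coprime? k m) (applyUpTo suc m))

radFactor : ℕ → ℕ → ℕ
radFactor n i with does (prime? (suc i) ×-dec (suc i ∣? n))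
... | true  = suc i
... | false = 1

-- rad n = product of the distinct primes p ≤ n dividing n  (rad 1 = 1).
rad : ℕ → ℕ
rad n = product (applyUpTo (radFactor n) n)

private
  radFactor-nz : ∀ n i → NonZero (radFactor n i)
  radFactor-nz n i with does (prime? (suc i) ×-dec (suc i ∣? n))
  ... | true  = _
  ... | false = _

  prod-nz : ∀ (f : ℕ → ℕ) → (∀ i → NonZero (f i)) → ∀ k → NonZero (product (applyUpTo f k))
  prod-nz f h zero = _
  prod-nz f h (suc k) = m*n≢0 (f 0) _ {{h 0}} {{prod-nz (λ i → f (suc i)) (λ i → h (suc i)) k}}

rad-nonZero : ∀ n → NonZero (rad n)
rad-nonZero n = prod-nz (radFactor n) (radFactor-nz n) n

-- cosocle n = n / rad n  (exact division since rad n ∣ n for n ≥ 1)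
cosocle : ℕ → ℕ
cosocle n = _/_ n (rad n) {{rad-nonZero n}}

_≡_[mod_] : ℕ → ℕ → (m : ℕ) → .{{NonZero m}} → Set
a ≡ b [mod m ] = a % m ≡ b % m

ExponentKillsUnits : (m : ℕ) → .{{NonZero m}} → ℕ → Set
ExponentKillsUnits m l = ∀ a → Coprime a m → (a ^ l) ≡ 1 [mod m ]

IsCarmichael : (m : ℕ) → .{{NonZero m}} → ℕ → Set
IsCarmichael m l =
  0 < l × ExponentKillsUnits m l × (∀ l′ → 0 < l′ → ExponentKillsUnits m l′ → l ≤ l′)

IsAbcTriple : ℕ → ℕ → ℕ → Set
IsAbcTriple a b c =
  0 < a × 0 < b × 0 < c × Coprime a b × Coprime a c × Coprime b c ×
  a + b ≡ c × rad (a * b * c) < c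

-- Both t = λ(m) and t = φ(m) (Euler's theorem) satisfy n^t ≡ 1 (mod m), hence so does
-- N = n^(tk).  Writing N − 1 = qm, every prime of (N − 1)N divides rad(m)·q·rad(n), so
--   rad((N − 1)N) ≤ rad(m)·q·rad(n) < rad(m)·q·cosocle(m) = qm = N − 1 < N.
module Submission where

open import Defs
open import Data.Bool using (true; false)
open import Data.Empty using (⊥-elim)
open import Data.List using (List; []; _∷_; _++_; [_]; applyUpTo; filter; length; map)
open import Data.List.Properties using (applyUpTo-∷ʳ; length-++; length-map)
open import Data.List.Membership.Propositional using (_∈_)
open import Data.List.Membership.Propositional.Properties
  using (∈-filter⁺; ∈-filter⁻; ∈-applyUpTo⁺; ∈-applyUpTo⁻; ∈-map⁻; ∈-length; ∈-∃++; ∈-++⁻; ∈-++⁺ˡ; ∈-++⁺ʳ)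
open import Data.List.Relation.Unary.Any using (here; there)
open import Data.List.Relation.Unary.All as All using (All; []; _∷_)
import Data.List.Relation.Unary.AllPairs as AllPairs
open import Data.List.Relation.Unary.Unique.Propositional using (Unique)
open import Data.List.Relation.Unary.Unique.Propositional.Properties using (filter⁺; applyUpTo⁺₁)
open import Data.List.Relation.Binary.Permutation.Propositional using (_↭_; ↭-sym; ↭-trans; ↭-prep; ↭-refl)
open import Data.List.Relation.Binary.Permutation.Propositional.Properties using (shift)
open import Data.Nat
open import Data.Nat.Properties
open import Data.Nat.DivMod
open import Data.Nat.Divisibility
open import Data.Nat.Primality
open import Data.Nat.Coprimality as Coprimality using (Coprime; coprime?; coprime-divisor)
open import Data.Nat.ListAction using (product)
open import Data.Nat.ListAction.Properties using (product-++; product-↭)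
open import Data.Nat.Tactic.RingSolver using (solve-∀)
open import Data.Product using (_×_; _,_; proj₁; proj₂)
open import Data.Sum using (_⊎_; inj₁; inj₂)
open import Function using (_∘_; case_of_)
open import Relation.Nullary using (¬_; does; proof; Reflects)
open import Relation.Nullary.Reflects using (invert)
open import Relation.Nullary.Decidable using (_×-dec_)
open import Relation.Binary.PropositionalEquality hiding ([_])

%≡%⇒∣∸ : ∀ a b m .{{_ : NonZero m}} → a % m ≡ b % m → m ∣ a ∸ b
%≡%⇒∣∸ a b m eq = divides (a / m ∸ b / m) (begin
    a ∸ b                                     ≡⟨ cong₂ _∸_ (m≡m%n+[m/n]*n a m) (m≡m%n+[m/n]*n b m) ⟩
    (a % m + a / m * m) ∸ (b % m + b / m * m) ≡⟨ cong (λ r → (r + a / m * m) ∸ (b % m + b / m * m)) eq ⟩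
    (b % m + a / m * m) ∸ (b % m + b / m * m) ≡⟨ [m+n]∸[m+o]≡n∸o (b % m) _ _ ⟩
    a / m * m ∸ b / m * m                     ≡⟨ *-distribʳ-∸ m (a / m) (b / m) ⟨
    (a / m ∸ b / m) * m                       ∎)
  where open ≡-Reasoning

∣∸⇒%≡% : ∀ a b m .{{_ : NonZero m}} → b ≤ a → m ∣ a ∸ b → a % m ≡ b % m
∣∸⇒%≡% a b m b≤a m∣a∸b = trans (cong (_% m) (sym (m+[n∸m]≡n b≤a))) (%-remove-+ʳ b m∣a∸b)

%≡1⇒^%≡1 : ∀ a k m .{{_ : NonZero m}} → a % m ≡ 1 % m → a ^ k % m ≡ 1 % m
%≡1⇒^%≡1 a zero    m a≡1 = refl
%≡1⇒^%≡1 a (suc k) m a≡1 = begin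
    a * a ^ k % m                   ≡⟨ %-distribˡ-* a (a ^ k) m ⟩
    (a % m) * (a ^ k % m) % m       ≡⟨ cong₂ (λ u v → u * v % m) a≡1 (%≡1⇒^%≡1 a k m a≡1) ⟩
    (1 % m) * (1 % m) % m           ≡⟨ %-distribˡ-* 1 1 m ⟨
    1 % m                           ∎
  where open ≡-Reasoning

coprime-* : ∀ {a b m} → Coprime a m → Coprime b m → Coprime (a * b) m
coprime-* {a} a⊥m b⊥m (d∣ab , d∣m) = b⊥m (coprime-divisor d⊥a d∣ab , d∣m)
  where
  d⊥a : Coprime _ a
  d⊥a (e∣d , e∣a) = a⊥m (e∣a , ∣-trans e∣d d∣m)

coprime-product : ∀ {m} xs → All (λ x → Coprime x m) xs → Coprime (product xs) m
coprime-product []       []           = Coprimality.1-coprimeTo _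
coprime-product (x ∷ xs) (x⊥m ∷ xs⊥m) = coprime-* x⊥m (coprime-product xs xs⊥m)

coprime-suc : ∀ n → Coprime n (suc n)
coprime-suc n {d} (d∣n , d∣1+n) = ∣1⇒≡1 (∣m+n∣m⇒∣n (subst (d ∣_) (+-comm 1 n) d∣1+n) d∣n)

coprime∧∣∧∣⇒*∣ : ∀ {a b y} → Coprime b a → a ∣ y → b ∣ y → a * b ∣ y
coprime∧∣∧∣⇒*∣ {a} {b} b⊥a (divides t refl) b∣ta
  with coprime-divisor b⊥a (subst (b ∣_) (*-comm t a) b∣ta)
... | divides s refl = divides s (trans (*-assoc s b a) (cong (s *_) (*-comm b a)))

prime∤1 : ∀ {p} → Prime p → ¬ p ∣ 1
prime∤1 p-prime p∣1 = nonTrivial⇒≢1 {{prime⇒nonTrivial p-prime}} (∣1⇒≡1 p∣1)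

prime∤⇒coprime : ∀ {p n} → Prime p → ¬ p ∣ n → Coprime p n
prime∤⇒coprime p-prime p∤n (d∣p , d∣n) with prime⇒irreducible p-prime d∣p
... | inj₁ d≡1 = d≡1
... | inj₂ refl = ⊥-elim (p∤n d∣n)

prime∣^⇒prime∣ : ∀ {p} n e → Prime p → p ∣ n ^ e → p ∣ n
prime∣^⇒prime∣ n zero    p-prime p∣1 = ⊥-elim (prime∤1 p-prime p∣1)
prime∣^⇒prime∣ n (suc e) p-prime p∣n*nᵉ with euclidsLemma n (n ^ e) p-prime p∣n*nᵉ
... | inj₁ p∣n  = p∣n
... | inj₂ p∣nᵉ = prime∣^⇒prime∣ n e p-prime p∣nᵉ

unique-map⁺ : ∀ (f : ℕ → ℕ) xs → (∀ {x y} → x ∈ xs → y ∈ xs → f x ≡ f y → x ≡ y) →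
              Unique xs → Unique (map f xs)
unique-map⁺ f []       f-inj AllPairs.[]           = AllPairs.[]
unique-map⁺ f (x ∷ xs) f-inj (x∉xs AllPairs.∷ xs!) =
  All.tabulate fx∉ AllPairs.∷ unique-map⁺ f xs (λ y∈ z∈ → f-inj (there y∈) (there z∈)) xs!
  where
  fx∉ : ∀ {y} → y ∈ map f xs → f x ≢ y
  fx∉ y∈ fx≡y with ∈-map⁻ f y∈
  ... | z , z∈ , refl = All.lookup x∉xs z∈ (f-inj (here refl) (there z∈) fx≡y)

unique∧⊆∧length≡⇒↭ : ∀ (xs ys : List ℕ) → Unique xs → (∀ {x} → x ∈ xs → x ∈ ys) →
                     length xs ≡ length ys → xs ↭ ys
unique∧⊆∧length≡⇒↭ []       []      _ _ _ = ↭-refl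
unique∧⊆∧length≡⇒↭ (x ∷ xs) ys (x∉xs AllPairs.∷ xs!) xs⊆ys |xs|≡|ys|
  with ∈-∃++ (xs⊆ys (here refl))
... | as , bs , refl =
  ↭-trans (↭-prep x (unique∧⊆∧length≡⇒↭ xs (as ++ bs) xs! xs⊆as++bs |xs|≡|as++bs|))
          (↭-sym (shift x as bs))
  where
  xs⊆as++bs : ∀ {z} → z ∈ xs → z ∈ as ++ bs
  xs⊆as++bs z∈xs with ∈-++⁻ as (xs⊆ys (there z∈xs))
  ... | inj₁ z∈as          = ∈-++⁺ˡ z∈as
  ... | inj₂ (here refl)   = ⊥-elim (All.lookup x∉xs z∈xs refl)
  ... | inj₂ (there z∈bs)  = ∈-++⁺ʳ as z∈bs
  |xs|≡|as++bs| : length xs ≡ length (as ++ bs)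
  |xs|≡|as++bs| = suc-injective (begin
    suc (length xs)              ≡⟨ |xs|≡|ys| ⟩
    length (as ++ x ∷ bs)        ≡⟨ length-++ as ⟩
    length as + suc (length bs)  ≡⟨ +-suc (length as) (length bs) ⟩
    suc (length as + length bs)  ≡⟨ cong suc (length-++ as) ⟨
    suc (length (as ++ bs))      ∎)
    where open ≡-Reasoning

radFactor-spec : ∀ x i →
  (radFactor x i ≡ suc i × Prime (suc i) × suc i ∣ x) ⊎
  (radFactor x i ≡ 1 × ¬ (Prime (suc i) × suc i ∣ x))
radFactor-spec x i with does (prime? (suc i) ×-dec (suc i ∣? x)) in eq
... | true  = inj₁ (refl , invert (subst (Reflects _) eq (proof (prime? (suc i) ×-dec (suc i ∣? x)))))
... | false = inj₂ (refl , invert (subst (Reflects _) eq (proof (prime? (suc i) ×-dec (suc i ∣? x)))))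

product-applyUpTo-suc : ∀ (f : ℕ → ℕ) B → product (applyUpTo f (suc B)) ≡ product (applyUpTo f B) * f B
product-applyUpTo-suc f B = begin
    product (applyUpTo f (suc B))       ≡⟨ cong product (applyUpTo-∷ʳ f B) ⟨
    product (applyUpTo f B ++ [ f B ])  ≡⟨ product-++ (applyUpTo f B) [ f B ] ⟩
    product (applyUpTo f B) * (f B * 1) ≡⟨ cong (product (applyUpTo f B) *_) (*-identityʳ (f B)) ⟩
    product (applyUpTo f B) * f B       ∎
  where open ≡-Reasoning

∣-product-applyUpTo : ∀ (f : ℕ → ℕ) B i → i < B → f i ∣ product (applyUpTo f B)
∣-product-applyUpTo f (suc B) i i<1+B rewrite product-applyUpTo-suc f B
  with m≤n⇒m<n∨m≡n (≤-pred i<1+B)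
... | inj₁ i<B  = ∣m⇒∣m*n (f B) (∣-product-applyUpTo f B i i<B)
... | inj₂ refl = ∣n⇒∣m*n (product (applyUpTo f B)) ∣-refl

radPrefix : ℕ → ℕ → ℕ
radPrefix x B = product (applyUpTo (radFactor x) B)

radPrefix-suc : ∀ x B → radPrefix x (suc B) ≡ radPrefix x B * radFactor x B
radPrefix-suc x = product-applyUpTo-suc (radFactor x)

prime∣radPrefix⇒≤ : ∀ {p} x B → Prime p → p ∣ radPrefix x B → p ≤ B
prime∣radPrefix⇒≤ x zero    p-prime p∣1 = ⊥-elim (prime∤1 p-prime p∣1)
prime∣radPrefix⇒≤ x (suc B) p-prime p∣P rewrite radPrefix-suc x B
  with euclidsLemma (radPrefix x B) (radFactor x B) p-prime p∣P | radFactor-spec x B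
... | inj₁ p∣prefix | _ = m≤n⇒m≤1+n (prime∣radPrefix⇒≤ x B p-prime p∣prefix)
... | inj₂ p∣factor | inj₁ (eq , _) = ∣⇒≤ (subst (_ ∣_) eq p∣factor)
... | inj₂ p∣factor | inj₂ (eq , _) = ⊥-elim (prime∤1 p-prime (subst (_ ∣_) eq p∣factor))

radPrefix∣ : ∀ x y B → (∀ p → Prime p → p ∣ x → p ∣ y) → radPrefix x B ∣ y
radPrefix∣ x y zero    primes = 1∣ y
radPrefix∣ x y (suc B) primes rewrite radPrefix-suc x B with radFactor-spec x B
... | inj₁ (eq , p-prime , p∣x) rewrite eq =
  coprime∧∣∧∣⇒*∣ (prime∤⇒coprime p-prime (λ p∣P → <-irrefl refl (prime∣radPrefix⇒≤ x B p-prime p∣P)))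
                  (radPrefix∣ x y B primes) (primes (suc B) p-prime p∣x)
... | inj₂ (eq , _) rewrite eq | *-identityʳ (radPrefix x B) = radPrefix∣ x y B primes

rad∣ : ∀ x y → (∀ p → Prime p → p ∣ x → p ∣ y) → rad x ∣ y
rad∣ x y = radPrefix∣ x y x

prime∣⇒∣rad : ∀ {p} x .{{_ : NonZero x}} → Prime p → p ∣ x → p ∣ rad x
prime∣⇒∣rad {zero}  x p-prime _ = ⊥-elim (≢-nonZero⁻¹ 0 {{prime⇒nonZero p-prime}} refl)
prime∣⇒∣rad {suc i} x p-prime p∣x with radFactor-spec x i
... | inj₁ (eq , _)  = subst (_∣ rad x) eq (∣-product-applyUpTo (radFactor x) x i (∣⇒≤ p∣x))
... | inj₂ (_ , ¬p) = ⊥-elim (¬p (p-prime , p∣x))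

rad*cosocle≡ : ∀ m .{{_ : NonZero m}} → rad m * cosocle m ≡ m
rad*cosocle≡ m = m*[n/m]≡n {{rad-nonZero m}} (rad∣ m m (λ _ _ p∣m → p∣m))


units : ℕ → List ℕ
units m = filter (λ k → coprime? k m) (applyUpTo suc m)

φ-pos : ∀ m .{{_ : NonZero m}} → 0 < φ m
φ-pos (suc m) = ∈-length (∈-filter⁺ (λ k → coprime? k (suc m)) (∈-applyUpTo⁺ suc {0} z<s)
                                      (Coprimality.1-coprimeTo (suc m)))

coprime⇒*-cancelˡ-% : ∀ {m n x y} .{{_ : NonZero m}} → Coprime m n → x < m →
                      n * x % m ≡ n * y % m → x ≤ y
coprime⇒*-cancelˡ-% {m} {n} {x} {y} m⊥n x<m nx≡ny
  with coprime-divisor m⊥n (subst (m ∣_) (sym (*-distribˡ-∸ n x y)) (%≡%⇒∣∸ (n * x) (n * y) m nx≡ny))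
... | m∣x∸y with x ∸ y in x∸y≡
...   | zero  = m∸n≡0⇒m≤n x∸y≡
...   | suc _ = ⊥-elim (<⇒≱ (≤-<-trans (subst (_≤ x) x∸y≡ (m∸n≤m x y)) x<m) (∣⇒≤ m∣x∸y))

product-map-*% : ∀ m .{{_ : NonZero m}} n xs →
                 product (map (λ x → n * x % m) xs) % m ≡ n ^ length xs * product xs % m
product-map-*% m n []       = refl
product-map-*% m n (x ∷ xs) = begin
    (n * x % m) * product (map (λ x → n * x % m) xs) % m  ≡⟨ %-distribˡ-* (n * x % m) _ m ⟩
    (n * x % m % m) * (product (map _ xs) % m) % m        ≡⟨ cong₂ (λ a b → a * b % m) (m%n%n≡m%n (n * x) m) (product-map-*% m n xs) ⟩
    (n * x % m) * (n ^ length xs * product xs % m) % m    ≡⟨ %-distribˡ-* (n * x) _ m ⟨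
    (n * x) * (n ^ length xs * product xs) % m            ≡⟨ cong (_% m) (interchange n x (n ^ length xs) (product xs)) ⟩
    n * n ^ length xs * (x * product xs) % m              ∎
  where
  open ≡-Reasoning
  interchange : ∀ a b c d → (a * b) * (c * d) ≡ a * c * (b * d)
  interchange = solve-∀

-- Multiplication by n permutes the residues coprime to m, so both products of units agree mod m.
module Euler (m : ℕ) .{{_ : NonTrivial m}} (n : ℕ) (m⊥n : Coprime m n) where

  instance
    m≢0 : NonZero m
    m≢0 = nonTrivial⇒nonZero m

  mulMod : ℕ → ℕ
  mulMod x = n * x % m

  ∈units⇒ : ∀ {x} → x ∈ units m → x < m × Coprime x m
  ∈units⇒ x∈ with ∈-filter⁻ (λ k → coprime? k m) {xs = applyUpTo suc m} x∈
  ... | x∈range , x⊥m with ∈-applyUpTo⁻ suc x∈range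
  ...   | i , i<m , refl with m≤n⇒m<n∨m≡n i<m
  ...     | inj₁ x<m  = x<m , x⊥m
  ...     | inj₂ refl = ⊥-elim (nonTrivial⇒≢1 {m} (x⊥m (∣-refl , ∣-refl)))

  ∈units⁺ : ∀ {x} → x < m → Coprime x m → x ∈ units m
  ∈units⁺ {zero}  _   x⊥m = ⊥-elim (Coprimality.¬0-coprimeTo-2+ x⊥m)
  ∈units⁺ {suc i} x<m x⊥m = ∈-filter⁺ (λ k → coprime? k m) (∈-applyUpTo⁺ suc (<-trans (n<1+n i) x<m)) x⊥m

  units-unique : Unique (units m)
  units-unique = filter⁺ (λ k → coprime? k m) (applyUpTo⁺₁ suc m (λ i<j _ → <⇒≢ i<j ∘ suc-injective))

  mulMod-coprime : ∀ {x} → Coprime x m → Coprime (mulMod x) m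
  mulMod-coprime x⊥m {d} (d∣nx%m , d∣m) = x⊥m (coprime-divisor d⊥n (∣n∣m%n⇒∣m d∣m d∣nx%m) , d∣m)
    where
    d⊥n : Coprime d n
    d⊥n (e∣d , e∣n) = m⊥n (∣-trans e∣d d∣m , e∣n)

  mulMod-units : ∀ {x} → x ∈ units m → mulMod x ∈ units m
  mulMod-units x∈ = ∈units⁺ (m%n<n (n * _) m) (mulMod-coprime (proj₂ (∈units⇒ x∈)))

  mulMod-injective : ∀ {x y} → x ∈ units m → y ∈ units m → mulMod x ≡ mulMod y → x ≡ y
  mulMod-injective x∈ y∈ eq = ≤-antisym (coprime⇒*-cancelˡ-% m⊥n (proj₁ (∈units⇒ x∈)) eq)
                                        (coprime⇒*-cancelˡ-% m⊥n (proj₁ (∈units⇒ y∈)) (sym eq))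

  map-mulMod-units↭ : map mulMod (units m) ↭ units m
  map-mulMod-units↭ = unique∧⊆∧length≡⇒↭ (map mulMod (units m)) (units m)
    (unique-map⁺ mulMod (units m) mulMod-injective units-unique)
    (λ y∈ → case ∈-map⁻ mulMod y∈ of λ { (x , x∈ , refl) → mulMod-units x∈ })
    (length-map mulMod (units m))

  m∣n^φ∸1 : m ∣ n ^ φ m ∸ 1
  m∣n^φ∸1 = coprime-divisor (Coprimality.sym P⊥m)
              (subst (m ∣_) n^φP∸P≡P[n^φ∸1] (%≡%⇒∣∸ (n ^ φ m * P) P m (sym P≡n^φP)))
    where
    P : ℕ
    P = product (units m)
    P≡n^φP : P % m ≡ n ^ φ m * P % m
    P≡n^φP = trans (cong (_% m) (sym (product-↭ map-mulMod-units↭))) (product-map-*% m n (units m))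
    P⊥m : Coprime P m
    P⊥m = coprime-product (units m) (All.tabulate (λ x∈ → proj₂ (∈units⇒ x∈)))
    n^φP∸P≡P[n^φ∸1] : n ^ φ m * P ∸ P ≡ P * (n ^ φ m ∸ 1)
    n^φP∸P≡P[n^φ∸1] = begin
      n ^ φ m * P ∸ P      ≡⟨ cong (n ^ φ m * P ∸_) (*-identityˡ P) ⟨
      n ^ φ m * P ∸ 1 * P  ≡⟨ *-distribʳ-∸ P (n ^ φ m) 1 ⟨
      (n ^ φ m ∸ 1) * P    ≡⟨ *-comm _ P ⟩
      P * (n ^ φ m ∸ 1)    ∎
      where open ≡-Reasoning

euler : ∀ m .{{_ : NonZero m}} n → Coprime m n → n ^ φ m % m ≡ 1 % m
euler 1                 n         _   = trans (n%1≡0 (n ^ φ 1)) (sym (n%1≡0 1))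
euler m@(suc (suc _))   zero      m⊥0 = ⊥-elim (Coprimality.¬0-coprimeTo-2+ {m} (Coprimality.sym m⊥0))
euler m@(suc (suc _))   n@(suc _) m⊥n = ∣∸⇒%≡% (n ^ φ m) 1 m (m^n>0 n (φ m)) (Euler.m∣n^φ∸1 m n m⊥n)

1<rad⇒2≤ : ∀ n → 1 < rad n → 2 ≤ n
1<rad⇒2≤ 0             (s≤s ())
1<rad⇒2≤ 1             (s≤s ())
1<rad⇒2≤ (suc (suc _)) _        = s≤s (s≤s z≤n)

2≤^ : ∀ n e .{{_ : NonZero e}} → 2 ≤ n → 2 ≤ n ^ e
2≤^ n (suc e) 2≤n = ≤-trans 2≤n (m≤m*n n (n ^ e) {{m^n≢0 n e {{>-nonZero (<-trans z<s 2≤n)}}}})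

isAbcTriple-consecutive : ∀ N → 2 ≤ N → rad ((N ∸ 1) * N) < N → IsAbcTriple 1 (N ∸ 1) N
isAbcTriple-consecutive N@(suc M@(suc _)) (s≤s (s≤s z≤n)) rad<N =
  z<s , z<s , z<s , Coprimality.1-coprimeTo M , Coprimality.1-coprimeTo N , coprime-suc M , refl ,
  subst (λ a → rad (a * N) < N) (sym (*-identityˡ M)) rad<N

rad[[N∸1]*N]<N : ∀ m .{{_ : NonZero m}} n .{{_ : NonZero n}} N → rad n < cosocle m → 2 ≤ N →
                (∀ p → Prime p → p ∣ N → p ∣ n) → m ∣ N ∸ 1 → rad ((N ∸ 1) * N) < N
rad[[N∸1]*N]<N m n N rad<cos 2≤N primes-of-N (divides q N∸1≡qm) = begin-strict
    rad ((N ∸ 1) * N)        ≤⟨ ∣⇒≤ {{bound≢0}} (rad∣ _ _ primes-of-product) ⟩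
    rad m * q * rad n        <⟨ *-monoʳ-< (rad m * q) {{radm*q≢0}} rad<cos ⟩
    rad m * q * cosocle m    ≡⟨ reorder (rad m) q (cosocle m) ⟩
    q * (rad m * cosocle m)  ≡⟨ cong (q *_) (rad*cosocle≡ m) ⟩
    q * m                    ≡⟨ N∸1≡qm ⟨
    N ∸ 1                    ≤⟨ m∸n≤m N 1 ⟩
    N                        ∎
  where
  open ≤-Reasoning
  reorder : ∀ a b c → a * b * c ≡ b * (a * c)
  reorder = solve-∀
  q≢0 : NonZero q
  q≢0 = ≢-nonZero (λ { refl → <⇒≢ (m<n⇒0<n∸m 2≤N) (sym N∸1≡qm) })
  radm*q≢0 : NonZero (rad m * q)
  radm*q≢0 = m*n≢0 (rad m) q {{rad-nonZero m}} {{q≢0}}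
  bound≢0 : NonZero (rad m * q * rad n)
  bound≢0 = m*n≢0 (rad m * q) (rad n) {{radm*q≢0}} {{rad-nonZero n}}
  primes-of-product : ∀ p → Prime p → p ∣ (N ∸ 1) * N → p ∣ rad m * q * rad n
  primes-of-product p p-prime p∣ with euclidsLemma (N ∸ 1) N p-prime p∣
  ... | inj₂ p∣N = ∣n⇒∣m*n (rad m * q) (prime∣⇒∣rad n p-prime (primes-of-N p p-prime p∣N))
  ... | inj₁ p∣N∸1 with euclidsLemma q m p-prime (subst (p ∣_) N∸1≡qm p∣N∸1)
  ...   | inj₁ p∣q = ∣m⇒∣m*n (rad n) (∣n⇒∣m*n (rad m) p∣q)
  ...   | inj₂ p∣m = ∣m⇒∣m*n (rad n) (∣m⇒∣m*n q (prime∣⇒∣rad m p-prime p∣m))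

abcTriple-of-^%≡1 : ∀ m .{{_ : NonZero m}} n t → rad n < cosocle m → 1 < rad n → 0 < t →
                    n ^ t % m ≡ 1 % m → (k : ℕ) → 0 < k → IsAbcTriple 1 (n ^ (t * k) ∸ 1) (n ^ (t * k))
abcTriple-of-^%≡1 m n t rad<cos 1<rad t>0 nᵗ≡1 k k>0 =
  isAbcTriple-consecutive N 2≤N
    (rad[[N∸1]*N]<N m n {{>-nonZero (<-trans z<s 2≤n)}} N rad<cos 2≤N
      (λ p p-prime → prime∣^⇒prime∣ n (t * k) p-prime)
      (%≡%⇒∣∸ N 1 m (subst (λ a → a % m ≡ 1 % m) (^-*-assoc n t k) (%≡1⇒^%≡1 (n ^ t) k m nᵗ≡1))))
  where
  N : ℕ
  N = n ^ (t * k)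
  2≤n : 2 ≤ n
  2≤n = 1<rad⇒2≤ n 1<rad
  2≤N : 2 ≤ N
  2≤N = 2≤^ n (t * k) {{m*n≢0 t k {{>-nonZero t>0}} {{>-nonZero k>0}}}} 2≤n

-- The hypothesis 0 < n is redundant: rad 0 = 1.
corollary3p4 : (m n : ℕ) → .{{_ : NonZero m}} → 0 < n → Coprime m n →
    rad n < cosocle m → 1 < rad n →
    (l : ℕ) → IsCarmichael m l →
    (k : ℕ) → 0 < k →
      IsAbcTriple 1 (n ^ (l * k) ∸ 1) (n ^ (l * k))
      × IsAbcTriple 1 (n ^ (φ m * k) ∸ 1) (n ^ (φ m * k))
corollary3p4 m n _ m⊥n rad<cos 1<rad l (l>0 , l-kills-units , _) k k>0 =
    abcTriple-of-^%≡1 m n l rad<cos 1<rad l>0 (l-kills-units n (Coprimality.sym m⊥n)) k k>0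
  , abcTriple-of-^%≡1 m n (φ m) rad<cos 1<rad (φ-pos m) (euler m n m⊥n) k k>0
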